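{- Let $n\ge 11$ with $n\equiv 0$ or $2\pmod 3$. If $n\equiv 2\pmod 3$, let $Y=\{\mathbf{v}_1,\ldots,\mathbf{v}_6\}$ where $\mathbf{v}_1=\overline{100}[n]$, $\mathbf{v}_2=0\cdot\overline{101}[n-1]$, $\mathbf{v}_3=\overline{101}[n-1]\cdot 1$, $\mathbf{v}_4=\overline{010}[n]$, $\mathbf{v}_5=1\cdot\overline{110}[n-1]$, $\mathbf{v}_6=\overline{110}[n-1]\cdot 0$. If $n\equiv 0\pmod 3$, let $Y=\{\mathbf{u}_1,\ldots,\mathbf{u}_9\}$ where $\mathbf{u}_1=\overline{100}[n]$, $\mathbf{u}_2=0\cdot\overline{011}[n-1]$, $\mathbf{u}_3=\overline{110}[n-1]\cdot 1$, $\mathbf{u}_4=\overline{001}[n]$, $\mathbf{u}_5=1\cdot\overline{110}[n-1]$, $\mathbf{u}_6=\overline{101}[n-1]\cdot 0$, $\mathbf{u}_7=\overline{010}[n]$, $\mathbf{u}_8=0\cdot\overline{101}[n-1]$, $\mathbf{u}_9=\overline{011}[n-1]\cdot 0$. Then $|T(\mathbf{y})|=\lceil n^2/3\rceil$ for every $\mathbf{y}\in Y$.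
   Context: For $\mathbf{x}=(x_0,\ldots,x_{n-1})\in\mathbb{F}_2^n$, the derivative is $\partial\mathbf{x}=(x_0+x_1,\ldots,x_{n-2}+x_{n-1})\in\mathbb{F}_2^{n-1}$, with $\partial^0\mathbf{x}=\mathbf{x}$ and $\partial^i\mathbf{x}=\partial(\partial^{i-1}\mathbf{x})$. The Steinhaus triangle is $T(\mathbf{x})=(\mathbf{x},\partial\mathbf{x},\ldots,\partial^{n-1}\mathbf{x})$; $|\mathbf{y}|$ is the number of ones of a binary sequence and $|T(\mathbf{x})|=\sum_{i=0}^{n-1}|\partial^i\mathbf{x}|$. Sequences are written as words; a dot denotes concatenation; $\overline{x_1\cdots x_p}[k]$ is the word of the first $k$ letters of the infinite periodic word $x_1\cdots x_px_1\cdots x_p\cdots$. -}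

module Defs where

open import Data.Bool using (Bool; true; false; _xor_)
open import Data.Nat using (ℕ; zero; suc; _+_; _*_; _∸_)
open import Data.Nat.DivMod using (_/_)
open import Data.List using (List; []; _∷_; _++_; length; map)
open import Data.Nat.ListAction using (sum)

-- binary words over F₂ = Bool (true = 1), addition in F₂ = xor

∂ : List Bool → List Bool
∂ []           = []
∂ (x ∷ [])     = []
∂ (x ∷ y ∷ xs) = (x xor y) ∷ ∂ (y ∷ xs)

∂^ : ℕ → List Bool → List Bool
∂^ zero    x = x
∂^ (suc i) x = ∂ (∂^ i x)

bit : Bool → ℕ
bit true  = 1
bit false = 0

weight : List Bool → ℕ
weight y = sum (map bit y)

-- |T(x)| = Σ_{i=0}^{n-1} |∂^i x|, n = length x
sumTo : ℕ → (ℕ → ℕ) → ℕ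
sumTo zero    f = 0
sumTo (suc k) f = sumTo k f + f k

steinhausWeight : List Bool → ℕ
steinhausWeight x = sumTo (length x) (λ i → weight (∂^ i x))

per3 : Bool → Bool → Bool → ℕ → List Bool
per3 a b c zero    = []
per3 a b c (suc k) = a ∷ per3 b c a k

ceilSqDiv3 : ℕ → ℕ
ceilSqDiv3 n = (n * n + 2) / 3

private
  O I : Bool
  O = false
  I = true

Yv : ℕ → List (List Bool)
Yv n =
  per3 I O O n ∷
  (O ∷ per3 I O I (n ∸ 1)) ∷
  (per3 I O I (n ∸ 1) ++ (I ∷ [])) ∷
  per3 O I O n ∷
  (I ∷ per3 I I O (n ∸ 1)) ∷
  (per3 I I O (n ∸ 1) ++ (O ∷ [])) ∷ []

Yu : ℕ → List (List Bool)
Yu n =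
  per3 I O O n ∷
  (O ∷ per3 O I I (n ∸ 1)) ∷
  (per3 I I O (n ∸ 1) ++ (I ∷ [])) ∷
  per3 O O I n ∷
  (I ∷ per3 I I O (n ∸ 1)) ∷
  (per3 I O I (n ∸ 1) ++ (O ∷ [])) ∷
  per3 O I O n ∷
  (O ∷ per3 I O I (n ∸ 1)) ∷
  (per3 O I I (n ∸ 1) ++ (O ∷ [])) ∷ []

module Submission where

-- Every word of Y is, up to reversal (which preserves |T|) and after at most one
-- derivative, a word p · w with w a prefix of a periodic word whose period abc has
-- even weight. For such a period a + b = c, so ∂ just rotates the period (∂(abc…) = cab…),
-- and three derivatives bring p · w back to the same shape, three letters shorter.
-- The three rows removed weigh their left edge plus two thirds of their length, so |T|
-- grows by 6q + const per period, which integrates to const + d q + 3 q² = ⌈n²/3⌉.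

open import Data.Bool using (Bool; true; false; _xor_)
open import Data.Bool.Properties using (xor-comm)
open import Data.List using (List; []; _∷_; _++_; _∷ʳ_; length; map; reverse)
open import Data.List.Membership.Propositional using (_∈_)
open import Data.List.Properties using (unfold-reverse; reverse-++; length-reverse; ++-identityʳ; reverse-map)
open import Data.List.Relation.Binary.Permutation.Propositional.Properties using (↭-reverse)
open import Data.List.Relation.Unary.Any using (here; there)
open import Data.Nat using (ℕ; zero; suc; _+_; _*_; _≤_; _%_)
open import Data.Nat.DivMod using (_/_; m≡m%n+[m/n]*n; m*n/n≡m; +-distrib-/-∣ʳ)
open import Data.Nat.Divisibility using (divides)
open import Data.Nat.ListAction using (sum)
open import Data.Nat.ListAction.Properties using (sum-↭)
open import Data.Nat.Properties using (+-assoc; +-identityʳ; *-zeroʳ; *-distribˡ-+)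
open import Data.Nat.Tactic.RingSolver using (solve-∀)
open import Data.Product using (_×_; _,_)
open import Relation.Binary.PropositionalEquality
open ≡-Reasoning

open import Defs

private
  O I : Bool
  O = false
  I = true

sumTo-cong : ∀ k {f g : ℕ → ℕ} → (∀ i → f i ≡ g i) → sumTo k f ≡ sumTo k g
sumTo-cong zero    f≗g = refl
sumTo-cong (suc k) f≗g = cong₂ _+_ (sumTo-cong k f≗g) (f≗g k)

sumTo-suc : ∀ k f → sumTo (suc k) f ≡ f 0 + sumTo k (λ i → f (suc i))
sumTo-suc zero    f = sym (+-identityʳ (f 0))
sumTo-suc (suc k) f = begin
  sumTo (suc k) f + f (suc k)                   ≡⟨ cong (_+ f (suc k)) (sumTo-suc k f) ⟩
  f 0 + sumTo k (λ i → f (suc i)) + f (suc k)   ≡⟨ +-assoc (f 0) _ _ ⟩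
  f 0 + sumTo (suc k) (λ i → f (suc i))         ∎

∂^-suc : ∀ i x → ∂^ (suc i) x ≡ ∂^ i (∂ x)
∂^-suc zero    x = refl
∂^-suc (suc i) x = cong ∂ (∂^-suc i x)

length-∂-∷ : ∀ a xs → length (∂ (a ∷ xs)) ≡ length xs
length-∂-∷ a []       = refl
length-∂-∷ a (b ∷ xs) = cong suc (length-∂-∷ b xs)

steinhausWeight-∷ : ∀ a xs →
  steinhausWeight (a ∷ xs) ≡ weight (a ∷ xs) + steinhausWeight (∂ (a ∷ xs))
steinhausWeight-∷ a xs = begin
  sumTo (suc (length xs)) (λ i → weight (∂^ i x))
    ≡⟨ sumTo-suc (length xs) _ ⟩
  weight x + sumTo (length xs) (λ i → weight (∂^ (suc i) x))
    ≡⟨ cong (weight x +_) (sumTo-cong (length xs) (λ i → cong weight (∂^-suc i x))) ⟩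
  weight x + sumTo (length xs) (λ i → weight (∂^ i (∂ x)))
    ≡⟨ cong (λ k → weight x + sumTo k (λ i → weight (∂^ i (∂ x)))) (sym (length-∂-∷ a xs)) ⟩
  weight x + steinhausWeight (∂ x) ∎
  where
  x : List Bool
  x = a ∷ xs

∂-∷ʳ-∷ʳ : ∀ ys b z → ∂ (ys ∷ʳ b ∷ʳ z) ≡ ∂ (ys ∷ʳ b) ∷ʳ (b xor z)
∂-∷ʳ-∷ʳ []           b z = refl
∂-∷ʳ-∷ʳ (y ∷ [])     b z = refl
∂-∷ʳ-∷ʳ (y ∷ y′ ∷ ys) b z = cong ((y xor y′) ∷_) (∂-∷ʳ-∷ʳ (y′ ∷ ys) b z)

∂-reverse : ∀ x → ∂ (reverse x) ≡ reverse (∂ x)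
∂-reverse []           = refl
∂-reverse (a ∷ [])     = refl
∂-reverse (a ∷ b ∷ xs) = begin
  ∂ (reverse (a ∷ b ∷ xs))                ≡⟨ cong ∂ (trans (unfold-reverse a (b ∷ xs)) (cong (_∷ʳ a) (unfold-reverse b xs))) ⟩
  ∂ (reverse xs ∷ʳ b ∷ʳ a)                ≡⟨ ∂-∷ʳ-∷ʳ (reverse xs) b a ⟩
  ∂ (reverse xs ∷ʳ b) ∷ʳ (b xor a)        ≡⟨ cong₂ (λ u v → ∂ u ∷ʳ v) (sym (unfold-reverse b xs)) (xor-comm b a) ⟩
  ∂ (reverse (b ∷ xs)) ∷ʳ (a xor b)       ≡⟨ cong (_∷ʳ (a xor b)) (∂-reverse (b ∷ xs)) ⟩
  reverse (∂ (b ∷ xs)) ∷ʳ (a xor b)       ≡⟨ sym (unfold-reverse (a xor b) (∂ (b ∷ xs))) ⟩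
  reverse (∂ (a ∷ b ∷ xs))                ∎

∂^-reverse : ∀ i x → ∂^ i (reverse x) ≡ reverse (∂^ i x)
∂^-reverse zero    x = refl
∂^-reverse (suc i) x = trans (cong ∂ (∂^-reverse i x)) (∂-reverse (∂^ i x))

weight-reverse : ∀ xs → weight (reverse xs) ≡ weight xs
weight-reverse xs = trans (cong sum (reverse-map bit xs)) (sum-↭ (↭-reverse (map bit xs)))

steinhausWeight-reverse : ∀ x → steinhausWeight (reverse x) ≡ steinhausWeight x
steinhausWeight-reverse x = begin
  sumTo (length (reverse x)) (λ i → weight (∂^ i (reverse x)))
    ≡⟨ cong (λ k → sumTo k (λ i → weight (∂^ i (reverse x)))) (length-reverse x) ⟩
  sumTo (length x) (λ i → weight (∂^ i (reverse x)))
    ≡⟨ sumTo-cong (length x) (λ i → trans (cong weight (∂^-reverse i x)) (weight-reverse (∂^ i x))) ⟩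
  steinhausWeight x ∎

steinhausWeight-∷ʳ : ∀ xs z → steinhausWeight (xs ∷ʳ z) ≡ steinhausWeight (z ∷ reverse xs)
steinhausWeight-∷ʳ xs z =
  trans (sym (steinhausWeight-reverse (xs ∷ʳ z))) (cong steinhausWeight (reverse-++ xs (z ∷ [])))

∂-per3 : ∀ a b c k → ∂ (per3 a b c (suc k)) ≡ per3 (a xor b) (b xor c) (c xor a) k
∂-per3 a b c zero    = refl
∂-per3 a b c (suc k) = cong ((a xor b) ∷_) (∂-per3 b c a k)

weight-per3 : ∀ a b c q → weight (per3 a b c (q * 3)) ≡ q * (bit a + bit b + bit c)
weight-per3 a b c zero    = refl
weight-per3 a b c (suc q) =
  trans (cong (λ w → bit a + (bit b + (bit c + w))) (weight-per3 a b c q)) (period (bit a) (bit b) (bit c) q)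
  where
  period : ∀ x y z q → x + (y + (z + q * (x + y + z))) ≡ suc q * (x + y + z)
  period = solve-∀

weight-per3-rotations : ∀ a b c k →
  weight (per3 a b c k) + weight (per3 b c a k) + weight (per3 c a b k) ≡ (bit a + bit b + bit c) * k
weight-per3-rotations a b c zero    = sym (*-zeroʳ (bit a + bit b + bit c))
weight-per3-rotations a b c (suc k) = begin
  (bit a + wb) + (bit b + wc) + (bit c + wa)   ≡⟨ regroup (bit a) (bit b) (bit c) wa wb wc ⟩
  (bit a + bit b + bit c) + (wb + wc + wa)     ≡⟨ cong (bit a + bit b + bit c +_) (weight-per3-rotations b c a k) ⟩
  (bit a + bit b + bit c) + (bit b + bit c + bit a) * k   ≡⟨ distribute (bit a) (bit b) (bit c) k ⟩
  (bit a + bit b + bit c) * suc k ∎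
  where
  wa wb wc : ℕ
  wa = weight (per3 a b c k)
  wb = weight (per3 b c a k)
  wc = weight (per3 c a b k)
  regroup : ∀ x y z u v w → (x + v) + (y + w) + (z + u) ≡ (x + y + z) + (v + w + u)
  regroup = solve-∀
  distribute : ∀ x y z k → (x + y + z) + (y + z + x) * k ≡ (x + y + z) * suc k
  distribute = solve-∀

per3-++-∷ : ∀ a b c q ws → per3 a b c (q * 3) ++ a ∷ ws ≡ a ∷ (per3 b c a (q * 3) ++ ws)
per3-++-∷ a b c zero    ws = refl
per3-++-∷ a b c (suc q) ws = cong (λ t → a ∷ b ∷ c ∷ t) (per3-++-∷ a b c q ws)

per3-∷ʳ : ∀ a b c q → per3 a b c (q * 3) ∷ʳ a ≡ per3 a b c (1 + q * 3)
per3-∷ʳ a b c q = trans (per3-++-∷ a b c q []) (cong (a ∷_) (++-identityʳ _))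

reverse-per3 : ∀ a b c q → reverse (per3 a b c (q * 3)) ≡ per3 c b a (q * 3)
reverse-per3 a b c zero    = refl
reverse-per3 a b c (suc q) = begin
  reverse ((a ∷ b ∷ c ∷ []) ++ per3 a b c (q * 3))   ≡⟨ reverse-++ (a ∷ b ∷ c ∷ []) (per3 a b c (q * 3)) ⟩
  reverse (per3 a b c (q * 3)) ++ c ∷ b ∷ a ∷ []     ≡⟨ cong (_++ c ∷ b ∷ a ∷ []) (reverse-per3 a b c q) ⟩
  per3 c b a (q * 3) ++ c ∷ b ∷ a ∷ []               ≡⟨ per3-++-∷ c b a q (b ∷ a ∷ []) ⟩
  c ∷ (per3 b a c (q * 3) ++ b ∷ a ∷ [])             ≡⟨ cong (c ∷_) (per3-++-∷ b a c q (a ∷ [])) ⟩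
  c ∷ b ∷ (per3 a c b (q * 3) ∷ʳ a)                  ≡⟨ cong (λ t → c ∷ b ∷ t) (per3-∷ʳ a c b q) ⟩
  per3 c b a (suc q * 3)                              ∎

reverse-per3₁ : ∀ a b c q → reverse (per3 a b c (1 + q * 3)) ≡ per3 a c b (1 + q * 3)
reverse-per3₁ a b c q = begin
  reverse (a ∷ per3 b c a (q * 3))     ≡⟨ unfold-reverse a (per3 b c a (q * 3)) ⟩
  reverse (per3 b c a (q * 3)) ∷ʳ a    ≡⟨ cong (_∷ʳ a) (reverse-per3 b c a q) ⟩
  per3 a c b (q * 3) ∷ʳ a              ≡⟨ per3-∷ʳ a c b q ⟩
  per3 a c b (1 + q * 3)               ∎

reverse-per3₂ : ∀ a b c q → reverse (per3 a b c (2 + q * 3)) ≡ per3 b a c (2 + q * 3)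
reverse-per3₂ a b c q = begin
  reverse (a ∷ per3 b c a (1 + q * 3))   ≡⟨ unfold-reverse a (per3 b c a (1 + q * 3)) ⟩
  reverse (per3 b c a (1 + q * 3)) ∷ʳ a  ≡⟨ cong (_∷ʳ a) (reverse-per3₁ b c a q) ⟩
  per3 b a c (1 + q * 3) ∷ʳ a            ≡⟨ cong (b ∷_) (per3-∷ʳ a c b q) ⟩
  per3 b a c (2 + q * 3)                 ∎

xor-rotate : ∀ {a b c} → c ≡ a xor b → b ≡ c xor a
xor-rotate {false} {false} refl = refl
xor-rotate {false} {true}  refl = refl
xor-rotate {true}  {false} refl = refl
xor-rotate {true}  {true}  refl = refl

xor-period : ∀ p {a b c} → c ≡ a xor b → ((p xor a) xor c) xor b ≡ p
xor-period false {false} {false} refl = refl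
xor-period false {false} {true}  refl = refl
xor-period false {true}  {false} refl = refl
xor-period false {true}  {true}  refl = refl
xor-period true  {false} {false} refl = refl
xor-period true  {false} {true}  refl = refl
xor-period true  {true}  {false} refl = refl
xor-period true  {true}  {true}  refl = refl

∂-per3-even : ∀ a b c k → c ≡ a xor b → ∂ (per3 a b c (suc k)) ≡ per3 c a b k
∂-per3-even a b c k even = trans (∂-per3 a b c k) (cong (λ (x , y , z) → per3 x y z k) rotation)
  where
  rotation : (a xor b , b xor c , c xor a) ≡ (c , a , b)
  rotation = cong₂ _,_ (sym even) (cong₂ _,_ (sym (xor-rotate {c} {a} (xor-rotate even))) (sym (xor-rotate even)))

steinhausWeight-∷-per3-even : ∀ p a b c k → c ≡ a xor b →
  steinhausWeight (p ∷ per3 a b c (suc k)) ≡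
    weight (p ∷ per3 a b c (suc k)) + steinhausWeight ((p xor a) ∷ per3 c a b k)
steinhausWeight-∷-per3-even p a b c k even =
  trans (steinhausWeight-∷ p (per3 a b c (suc k)))
        (cong (λ t → weight (p ∷ per3 a b c (suc k)) + steinhausWeight ((p xor a) ∷ t)) (∂-per3-even a b c k even))

-- The first letters of three consecutive rows of T(p · per3 a b c k); the fourth is p again.
leftEdge : Bool → Bool → Bool → ℕ
leftEdge p a c = bit p + bit (p xor a) + bit ((p xor a) xor c)

steinhausWeight-∷-per3-period : ∀ p a b c k → c ≡ a xor b →
  steinhausWeight (p ∷ per3 a b c (3 + k)) ≡
    leftEdge p a c + (bit a + bit b + bit c) * (2 + k) + steinhausWeight (p ∷ per3 a b c k)
steinhausWeight-∷-per3-period p a b c k even = begin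
  steinhausWeight (p ∷ per3 a b c (3 + k))
    ≡⟨ steinhausWeight-∷-per3-even p a b c (2 + k) even ⟩
  w₀ + steinhausWeight (p₁ ∷ per3 c a b (2 + k))
    ≡⟨ cong (w₀ +_) (steinhausWeight-∷-per3-even p₁ c a b (1 + k) (xor-rotate even)) ⟩
  w₀ + (w₁ + steinhausWeight (p₂ ∷ per3 b c a (1 + k)))
    ≡⟨ cong (λ t → w₀ + (w₁ + t)) (steinhausWeight-∷-per3-even p₂ b c a k (xor-rotate {c} {a} (xor-rotate even))) ⟩
  w₀ + (w₁ + (w₂ + steinhausWeight ((p₂ xor b) ∷ per3 a b c k)))
    ≡⟨ cong (λ x → w₀ + (w₁ + (w₂ + steinhausWeight (x ∷ per3 a b c k)))) (xor-period p even) ⟩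
  w₀ + (w₁ + (w₂ + R))
    ≡⟨ regroup (bit p) (bit p₁) (bit p₂) (bit a) (bit b) (bit c) wa wb wc R ⟩
  leftEdge p a c + (s * 2 + (wa + wb + wc)) + R
    ≡⟨ cong (λ t → leftEdge p a c + (s * 2 + t) + R) (weight-per3-rotations a b c k) ⟩
  leftEdge p a c + (s * 2 + s * k) + R
    ≡⟨ cong (λ t → leftEdge p a c + t + R) (sym (*-distribˡ-+ s 2 k)) ⟩
  leftEdge p a c + s * (2 + k) + R ∎
  where
  p₁ p₂ : Bool
  p₁ = p xor a
  p₂ = p₁ xor c
  s wa wb wc w₀ w₁ w₂ R : ℕ
  s  = bit a + bit b + bit c
  wa = weight (per3 a b c k)
  wb = weight (per3 b c a k)
  wc = weight (per3 c a b k)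
  w₀ = weight (p ∷ per3 a b c (3 + k))
  w₁ = weight (p₁ ∷ per3 c a b (2 + k))
  w₂ = weight (p₂ ∷ per3 b c a (1 + k))
  R  = steinhausWeight (p ∷ per3 a b c k)
  regroup : ∀ e₀ e₁ e₂ x y z u v w r →
    e₀ + (x + (y + (z + u))) + (e₁ + (z + (x + v)) + (e₂ + (y + w) + r)) ≡
      e₀ + e₁ + e₂ + ((x + y + z) * 2 + (u + v + w)) + r
  regroup = solve-∀

steinhausWeight-∷-per3 : ∀ p a b c r q → c ≡ a xor b → bit a + bit b + bit c ≡ 2 →
  steinhausWeight (p ∷ per3 a b c (r + q * 3)) ≡
    steinhausWeight (p ∷ per3 a b c r) + (leftEdge p a c + 2 * r + 1) * q + 3 * (q * q)
steinhausWeight-∷-per3 p a b c r zero    even two = begin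
  steinhausWeight (p ∷ per3 a b c (r + 0))   ≡⟨ cong (λ k → steinhausWeight (p ∷ per3 a b c k)) (+-identityʳ r) ⟩
  steinhausWeight (p ∷ per3 a b c r)         ≡⟨ no-growth (steinhausWeight (p ∷ per3 a b c r)) (leftEdge p a c + 2 * r + 1) ⟩
  steinhausWeight (p ∷ per3 a b c r) + (leftEdge p a c + 2 * r + 1) * 0 + 3 * (0 * 0) ∎
  where
  no-growth : ∀ x d → x ≡ x + d * 0 + 3 * (0 * 0)
  no-growth = solve-∀
steinhausWeight-∷-per3 p a b c r (suc q) even two = begin
  steinhausWeight (p ∷ per3 a b c (r + suc q * 3))
    ≡⟨ cong (λ k → steinhausWeight (p ∷ per3 a b c k)) (move-period r (q * 3)) ⟩
  steinhausWeight (p ∷ per3 a b c (3 + (r + q * 3)))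
    ≡⟨ steinhausWeight-∷-per3-period p a b c (r + q * 3) even ⟩
  e + (bit a + bit b + bit c) * (2 + (r + q * 3)) + steinhausWeight (p ∷ per3 a b c (r + q * 3))
    ≡⟨ cong₂ (λ s t → e + s * (2 + (r + q * 3)) + t) two (steinhausWeight-∷-per3 p a b c r q even two) ⟩
  e + 2 * (2 + (r + q * 3)) + (B + (e + 2 * r + 1) * q + 3 * (q * q))
    ≡⟨ square-growth e r B q ⟩
  B + (e + 2 * r + 1) * suc q + 3 * (suc q * suc q) ∎
  where
  e B : ℕ
  e = leftEdge p a c
  B = steinhausWeight (p ∷ per3 a b c r)
  move-period : ∀ r m → r + (3 + m) ≡ 3 + (r + m)
  move-period = solve-∀
  square-growth : ∀ e r B q →
    e + 2 * (2 + (r + q * 3)) + (B + (e + 2 * r + 1) * q + 3 * (q * q)) ≡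
      B + (e + 2 * r + 1) * suc q + 3 * (suc q * suc q)
  square-growth = solve-∀

steinhausWeight-per3 : ∀ a b c k →
  steinhausWeight (per3 a b c (suc k)) ≡
    weight (per3 a b c (suc k)) + steinhausWeight (per3 (a xor b) (b xor c) (c xor a) k)
steinhausWeight-per3 a b c k =
  trans (steinhausWeight-∷ a (per3 b c a k)) (cong (λ t → weight (per3 a b c (suc k)) + steinhausWeight t) (∂-per3 a b c k))

steinhausWeight-per3-from-∂ : ∀ a b c k q {B d} →
  weight (per3 a b c (suc k)) ≡ suc (q * 1) →
  steinhausWeight (per3 (a xor b) (b xor c) (c xor a) k) ≡ B + d * q + 3 * (q * q) →
  steinhausWeight (per3 a b c (suc k)) ≡ suc B + suc d * q + 3 * (q * q)
steinhausWeight-per3-from-∂ a b c k q {B} {d} top rest =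
  trans (steinhausWeight-per3 a b c k) (trans (cong₂ _+_ top rest) (add-row B d q))
  where
  add-row : ∀ B d q → suc (q * 1) + (B + d * q + 3 * (q * q)) ≡ suc B + suc d * q + 3 * (q * q)
  add-row = solve-∀

steinhausWeight-per3₁-∷ʳ : ∀ a b c z q →
  steinhausWeight (per3 a b c (1 + q * 3) ∷ʳ z) ≡ steinhausWeight (z ∷ per3 a c b (1 + q * 3))
steinhausWeight-per3₁-∷ʳ a b c z q =
  trans (steinhausWeight-∷ʳ (per3 a b c (1 + q * 3)) z) (cong (λ t → steinhausWeight (z ∷ t)) (reverse-per3₁ a b c q))

steinhausWeight-per3₂-∷ʳ : ∀ a b c z q →
  steinhausWeight (per3 a b c (2 + q * 3) ∷ʳ z) ≡ steinhausWeight (z ∷ per3 b a c (2 + q * 3))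
steinhausWeight-per3₂-∷ʳ a b c z q =
  trans (steinhausWeight-∷ʳ (per3 a b c (2 + q * 3)) z) (cong (λ t → steinhausWeight (z ∷ t)) (reverse-per3₂ a b c q))

steinhausWeight-Yv : ∀ q {y} → y ∈ Yv (2 + q * 3) → steinhausWeight y ≡ 2 + 4 * q + 3 * (q * q)
steinhausWeight-Yv q = λ where
    (here refl) →
      steinhausWeight-per3-from-∂ I O O (1 + q * 3) q {1} {3} (cong suc (weight-per3 O I O q)) (steinhausWeight-∷-per3 I O I I 0 q refl refl)
    (there (here refl)) → v₂
    (there (there (here refl))) → trans (steinhausWeight-per3₁-∷ʳ I O I I q) v₅
    (there (there (there (here refl)))) →
      steinhausWeight-per3-from-∂ O I O (1 + q * 3) q {1} {3} (cong suc (weight-per3 O O I q)) (steinhausWeight-∷-per3 I I O I 0 q refl refl)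
    (there (there (there (there (here refl))))) → v₅
    (there (there (there (there (there (here refl)))))) → trans (steinhausWeight-per3₁-∷ʳ I I O O q) v₂
  where
  v₂ : steinhausWeight (O ∷ per3 I O I (1 + q * 3)) ≡ 2 + 4 * q + 3 * (q * q)
  v₂ = steinhausWeight-∷-per3 O I O I 1 q refl refl
  v₅ : steinhausWeight (I ∷ per3 I I O (1 + q * 3)) ≡ 2 + 4 * q + 3 * (q * q)
  v₅ = steinhausWeight-∷-per3 I I I O 1 q refl refl

steinhausWeight-Yu : ∀ q {y} → y ∈ Yu (3 + q * 3) → steinhausWeight y ≡ 3 + 6 * q + 3 * (q * q)
steinhausWeight-Yu q = λ where
    (here refl) →
      steinhausWeight-per3-from-∂ I O O (2 + q * 3) q {2} {5} (cong suc (weight-per3 I O O q)) (steinhausWeight-∷-per3 I O I I 1 q refl refl)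
    (there (here refl)) → u₂
    (there (there (here refl))) → trans (steinhausWeight-per3₂-∷ʳ I I O I q) u₅
    (there (there (there (here refl)))) →
      steinhausWeight-per3-from-∂ O O I (2 + q * 3) q {2} {5} (cong suc (weight-per3 O O I q)) (steinhausWeight-∷-per3 O I I O 1 q refl refl)
    (there (there (there (there (here refl))))) → u₅
    (there (there (there (there (there (here refl)))))) → trans (steinhausWeight-per3₂-∷ʳ I O I O q) u₂
    (there (there (there (there (there (there (here refl))))))) →
      steinhausWeight-per3-from-∂ O I O (2 + q * 3) q {2} {5} (cong suc (weight-per3 O I O q)) (steinhausWeight-∷-per3 I I O I 1 q refl refl)
    (there (there (there (there (there (there (there (here refl)))))))) → u₈
    (there (there (there (there (there (there (there (there (here refl))))))))) → trans (steinhausWeight-per3₂-∷ʳ O I I O q) u₈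
  where
  u₂ : steinhausWeight (O ∷ per3 O I I (2 + q * 3)) ≡ 3 + 6 * q + 3 * (q * q)
  u₂ = steinhausWeight-∷-per3 O O I I 2 q refl refl
  u₅ : steinhausWeight (I ∷ per3 I I O (2 + q * 3)) ≡ 3 + 6 * q + 3 * (q * q)
  u₅ = steinhausWeight-∷-per3 I I I O 2 q refl refl
  u₈ : steinhausWeight (O ∷ per3 I O I (2 + q * 3)) ≡ 3 + 6 * q + 3 * (q * q)
  u₈ = steinhausWeight-∷-per3 O I O I 2 q refl refl

ceilSqDiv3-2+q*3 : ∀ q → ceilSqDiv3 (2 + q * 3) ≡ 2 + 4 * q + 3 * (q * q)
ceilSqDiv3-2+q*3 q = trans (cong (_/ 3) (square q)) (m*n/n≡m (2 + 4 * q + 3 * (q * q)) 3)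
  where
  square : ∀ q → (2 + q * 3) * (2 + q * 3) + 2 ≡ (2 + 4 * q + 3 * (q * q)) * 3
  square = solve-∀

ceilSqDiv3-3+q*3 : ∀ q → ceilSqDiv3 (3 + q * 3) ≡ 3 + 6 * q + 3 * (q * q)
ceilSqDiv3-3+q*3 q = begin
  ((3 + q * 3) * (3 + q * 3) + 2) / 3   ≡⟨ cong (_/ 3) (square q) ⟩
  (2 + t * 3) / 3                       ≡⟨ +-distrib-/-∣ʳ 2 {d = 3} (divides t refl) ⟩
  t * 3 / 3                             ≡⟨ m*n/n≡m t 3 ⟩
  t                                     ∎
  where
  t : ℕ
  t = 3 + 6 * q + 3 * (q * q)
  square : ∀ q → (3 + q * 3) * (3 + q * 3) + 2 ≡ 2 + (3 + 6 * q + 3 * (q * q)) * 3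
  square = solve-∀

n≡n%3+n/3*3 : ∀ n {r} → n % 3 ≡ r → n ≡ r + n / 3 * 3
n≡n%3+n/3*3 n n%3≡r = trans (m≡m%n+[m/n]*n n 3) (cong (_+ n / 3 * 3) n%3≡r)

proposition8p4 : (n : ℕ) → 11 ≤ n →
    ((n % 3 ≡ 2) → (y : List Bool) → y ∈ Yv n → steinhausWeight y ≡ ceilSqDiv3 n)
    × ((n % 3 ≡ 0) → (y : List Bool) → y ∈ Yu n → steinhausWeight y ≡ ceilSqDiv3 n)
proposition8p4 n 11≤n = onYv , onYu
  where
  onYv : n % 3 ≡ 2 → (y : List Bool) → y ∈ Yv n → steinhausWeight y ≡ ceilSqDiv3 n
  onYv n%3≡2 y = subst (λ m → y ∈ Yv m → steinhausWeight y ≡ ceilSqDiv3 m) (sym (n≡n%3+n/3*3 n n%3≡2))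
    (λ y∈Yv → trans (steinhausWeight-Yv (n / 3) y∈Yv) (sym (ceilSqDiv3-2+q*3 (n / 3))))
  onYu : n % 3 ≡ 0 → (y : List Bool) → y ∈ Yu n → steinhausWeight y ≡ ceilSqDiv3 n
  onYu n%3≡0 y with n / 3 | n≡n%3+n/3*3 n n%3≡0
  ... | zero  | n≡0 with () ← subst (11 ≤_) n≡0 11≤n
  ... | suc q | n≡3+q*3 = subst (λ m → y ∈ Yu m → steinhausWeight y ≡ ceilSqDiv3 m) (sym n≡3+q*3)
    (λ y∈Yu → trans (steinhausWeight-Yu q y∈Yu) (sym (ceilSqDiv3-3+q*3 q)))
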